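{- Let $0<\alpha<1$ and let $G$ be an $\alpha$-joined bipartite graph with bipartition $(V_0,V_1)$, $|V_0|=|V_1|=N$. Then $G$ contains an induced subgraph $G'$ with bipartition $(V_0',V_1')$, $V_i'\subseteq V_i$, satisfying: \begin{enumerate} \item $|V_0'|,|V_1'|\geq(1-\alpha)N$; \item for every $i\in\{0,1\}$ and every $U\subseteq V_i'$ with $0<|U|\leq\alpha N$, $|N_{G'}(U)|>\frac{1-2\alpha}{2\alpha}|U|$; \item for every $i\in\{0,1\}$ and every $U\subseteq V_i'$ with $|U|>\alpha N$, $|N_{G'}(U)|>(1-2\alpha)N$. \end{enumerate}
   Context: A bipartite graph $G$ with bipartition $(V_0,V_1)$, $|V_0|=|V_1|=N$, is called $\alpha$-joined (for a real $\alpha>0$) if for every $A\subseteq V_0$ and $B\subseteq V_1$ with $|A|,|B|\geq\alpha N$ there is at least one edge of $G$ between $A$ and $B$. For $U\subseteq V(G')$, $N_{G'}(U)$ denotes the union of the neighbourhoods in $G'$ of the vertices of $U$.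
   Formalization: The parameter α ranges over the rationals rather than the reals, both in the lemma and in the definition of an α-joined graph. -}

module Defs where

open import Data.Bool using (Bool; true; false; _∧_; _∨_)
open import Data.Nat using (ℕ)
open import Data.Fin using (Fin)
open import Data.Fin.Subset using (Subset; _∈_; ∣_∣)
open import Data.Vec using (tabulate; lookup; foldr′)
open import Data.Integer using (+_)
open import Data.Rational using (ℚ; 0ℚ; 1ℚ; _*_; _-_; _÷_; _≤_; _<_; _/_; positive)
open import Data.Rational.Properties using (pos⇒nonZero)
open import Relation.Binary.PropositionalEquality using (_≡_)

ℕ→ℚ : ℕ → ℚ
ℕ→ℚ n = (+ n) / 1

2ℚ : ℚ
2ℚ = 1ℚ Data.Rational.+ 1ℚ

-- A bipartite graph with bipartition (V₀ , V₁), V₀ = V₁ = Fin N (two disjoint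
-- copies), given by its adjacency: G x y = true iff x ∈ V₀ and y ∈ V₁ are adjacent.
BipGraph : ℕ → Set
BipGraph N = Fin N → Fin N → Bool

data Side : Set where
  side0 side1 : Side

adjFrom : ∀ {N} → Side → BipGraph N → Fin N → Fin N → Bool
adjFrom side0 G x y = G x y
adjFrom side1 G x y = G y x

Joined : ∀ {N} → ℚ → BipGraph N → Set
Joined {N} α G =
  (A B : Subset N) → α * ℕ→ℚ N ≤ ℕ→ℚ ∣ A ∣ → α * ℕ→ℚ N ≤ ℕ→ℚ ∣ B ∣ →
  Data.Product.∃ λ x → Data.Product.∃ λ y → x ∈ A Data.Product.× y ∈ B Data.Product.× G x y ≡ true
  where import Data.Product

-- Neighbourhood N_{G'}(U) of U ⊆ V_i' in the induced subgraph G' = G[V₀' ∪ V₁'],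
-- where W = V_{1-i}' is the opposite side of G'.
nbhd : ∀ {N} → Side → BipGraph N → (W U : Subset N) → Subset N
nbhd i G W U = tabulate λ y → lookup W y ∧ foldr′ _∨_ false (tabulate λ x → lookup U x ∧ adjFrom i G x y)

part : ∀ {N} → Side → Subset N → Subset N → Subset N
part side0 V₀' V₁' = V₀'
part side1 V₀' V₁' = V₁'

other : Side → Side
other side0 = side1
other side1 = side0

expConst : (α : ℚ) → 0ℚ < α → ℚ
expConst α 0<α = (1ℚ - 2ℚ * α) ÷ (2ℚ * α)
  where instance
    _ = pos⇒nonZero (2ℚ * α) {{positive (Data.Rational.Properties.*-monoʳ-<-pos 2ℚ {{_}} 0<α)}}

{-# OPTIONS --safe #-}

-- Let c = (1 − 2α)/(2α) and delete non-expanding sets greedily: while some U ⊆ V_i' with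
-- 0 < |U| ≤ αN has at most c|U| neighbours in the current subgraph, delete U from V_i'.
-- The part S_i deleted from V_i then has at most c|S_i| neighbours outside S_{1−i}, and it
-- stays of size at most αN: since G is α-joined, a set X ⊆ V_i with |X| ≥ αN misses fewer
-- than αN vertices of V_{1−i}, so it has more than (1 − 2α)N neighbours outside S_{1−i};
-- but the first S_i ∪ U to exceed αN has size at most 2αN and hence at most
-- c·2αN = (1 − 2α)N such neighbours.  When no deletion is possible, (2) holds by
-- construction and (1), (3) follow from |S_i| ≤ αN and the same counting.

module Submission where

open import Defs
open import Data.Nat using (ℕ)
open import Data.Fin.Subset using (Subset; _⊆_; ∣_∣)
open import Data.Product using (Σ; ∃₂; _×_)
open import Data.Rational using (ℚ; 0ℚ; 1ℚ; _*_; _-_; _≤_; _<_)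

open import Data.Bool using (Bool; true; false; _∧_; _∨_)
open import Data.Empty using (⊥-elim)
open import Data.Fin using (Fin; zero; suc)
open import Data.Fin.Subset using (_∈_; _∪_; _∩_; ∁; ⊤; ⊥; inside; outside)
open import Data.Fin.Subset.Properties
  using (∣∁p∣≡n∸∣p∣; ∣p∣≤n; ∣⊥∣≡0; p⊆q⇒∣p∣≤∣q∣; p⊆p∪q; x∈p∪q⁺; x∈p∪q⁻; x∈p∩q⁻;
         x∈∁p⇒x∉p; x∉p⇒x∈∁p; ∉⊥; ∈⊤; Empty-unique; _∈?_; _⊆?_; anySubset?)
import Data.Integer as ℤ
import Data.Integer.Properties as ℤ
import Data.Nat as ℕ
import Data.Nat.Properties as ℕ
open import Data.Nat.Coprimality using (1-coprimeTo) renaming (sym to coprime-sym)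
open import Data.Nat.Induction using (<-wellFounded)
open import Data.Product using (∃; ∃-syntax; _,_)
open import Data.Rational using (mkℚ; _+_; -_; 1/_; *≤*; NonZero; positive; nonNegative; _≤?_; _<?_)
open import Data.Rational.Properties
  using (normalize-coprime; ≤-trans; ≤-reflexive; <-≤-trans; <-irrefl; <⇒≤; ≰⇒>; ≮⇒≥; +-mono-≤; +-mono-<-≤;
         +-monoʳ-≤; +-monoˡ-≤; +-monoˡ-<; *-distribˡ-+; *-assoc; *-identityʳ; *-inverseˡ; *-zeroˡ; *-zeroʳ;
         *-cancelʳ-≤-pos; *-monoˡ-≤-nonNeg; *-monoʳ-≤-nonNeg; *-monoʳ-<-pos; pos⇒nonZero; module ≤-Reasoning)
open import Data.Rational.Solver using (module +-*-Solver)
open import Data.Sum using (_⊎_; inj₁; inj₂)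
open import Data.Vec using (_∷_; []; tabulate; lookup; foldr′)
open import Data.Vec.Properties using (lookup∘tabulate; []=⇒lookup; lookup⇒[]=)
open import Function using (_∘_)
open import Induction.WellFounded using (Acc; acc)
open import Relation.Binary.PropositionalEquality
open import Relation.Nullary using (Dec; yes; no; ¬_)
open import Relation.Nullary.Decidable using (_×-dec_; map′)
open import Relation.Unary using (Pred)

ℕ→ℚ≡mkℚ : ∀ n → ℕ→ℚ n ≡ mkℚ (ℤ.+ n) 0 (coprime-sym (1-coprimeTo n))
ℕ→ℚ≡mkℚ n = normalize-coprime (coprime-sym (1-coprimeTo n))

ℕ→ℚ-+ : ∀ m n → ℕ→ℚ (m ℕ.+ n) ≡ ℕ→ℚ m + ℕ→ℚ n
ℕ→ℚ-+ m n
  rewrite ℕ→ℚ≡mkℚ m | ℕ→ℚ≡mkℚ n | ℕ.*-identityʳ m | ℕ.*-identityʳ n | ℤ.+◃n≡+n m | ℤ.+◃n≡+n n = refl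

ℕ→ℚ-mono-≤ : ∀ {m n} → m ℕ.≤ n → ℕ→ℚ m ≤ ℕ→ℚ n
ℕ→ℚ-mono-≤ {m} {n} m≤n = subst₂ _≤_ (sym (ℕ→ℚ≡mkℚ m)) (sym (ℕ→ℚ≡mkℚ n))
  (*≤* (subst₂ ℤ._≤_ (sym (ℤ.*-identityʳ (ℤ.+ m))) (sym (ℤ.*-identityʳ (ℤ.+ n))) (ℤ.+≤+ m≤n)))

ℕ→ℚ-cancel-< : ∀ {m n} → ℕ→ℚ m < ℕ→ℚ n → m ℕ.< n
ℕ→ℚ-cancel-< m<n = ℕ.≰⇒> λ n≤m → <-irrefl refl (<-≤-trans m<n (ℕ→ℚ-mono-≤ n≤m))

ℕ→ℚ-nonNeg : ∀ n → 0ℚ ≤ ℕ→ℚ n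
ℕ→ℚ-nonNeg n = ℕ→ℚ-mono-≤ {0} {n} ℕ.z≤n

open +-*-Solver

p≤q+r⇒p-r≤q : ∀ {p q r} → p ≤ q + r → p - r ≤ q
p≤q+r⇒p-r≤q {p} {q} {r} p≤q+r =
  subst (p - r ≤_) (solve 2 (λ q r → (q :+ r) :- r := q) refl q r) (+-monoˡ-≤ (- r) p≤q+r)

p<q+r⇒p-r<q : ∀ {p q r} → p < q + r → p - r < q
p<q+r⇒p-r<q {p} {q} {r} p<q+r =
  subst (p - r <_) (solve 2 (λ q r → (q :+ r) :- r := q) refl q r) (+-monoˡ-< (- r) p<q+r)

[1-α]n≡n-αn : ∀ α n → (1ℚ - α) * n ≡ n - α * n
[1-α]n≡n-αn = solve 2 (λ α n → (con 1ℚ :- α) :* n := n :- α :* n) refl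

[1-2α]n≡n-[αn+αn] : ∀ α n → (1ℚ - 2ℚ * α) * n ≡ n - (α * n + α * n)
[1-2α]n≡n-[αn+αn] = solve 2 (λ α n → (con 1ℚ :- con 2ℚ :* α) :* n := n :- (α :* n :+ α :* n)) refl

expConst-*-2α : ∀ α (0<α : 0ℚ < α) → expConst α 0<α * (2ℚ * α) ≡ 1ℚ - 2ℚ * α
expConst-*-2α α 0<α = begin
  (1ℚ - 2ℚ * α) * 1/ (2ℚ * α) * (2ℚ * α)   ≡⟨ *-assoc (1ℚ - 2ℚ * α) _ _ ⟩
  (1ℚ - 2ℚ * α) * (1/ (2ℚ * α) * (2ℚ * α)) ≡⟨ cong ((1ℚ - 2ℚ * α) *_) (*-inverseˡ (2ℚ * α)) ⟩
  (1ℚ - 2ℚ * α) * 1ℚ                       ≡⟨ *-identityʳ _ ⟩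
  1ℚ - 2ℚ * α                              ∎
  where
  open ≡-Reasoning
  instance
    2α≢0 : NonZero (2ℚ * α)
    2α≢0 = pos⇒nonZero (2ℚ * α) {{positive (*-monoʳ-<-pos 2ℚ 0<α)}}

expConst-*-[αn+αn] : ∀ α (0<α : 0ℚ < α) n → expConst α 0<α * (α * n + α * n) ≡ (1ℚ - 2ℚ * α) * n
expConst-*-[αn+αn] α 0<α n = begin
  c * (α * n + α * n) ≡⟨ solve 3 (λ c α n → c :* (α :* n :+ α :* n) := (c :* (con 2ℚ :* α)) :* n) refl c α n ⟩
  c * (2ℚ * α) * n    ≡⟨ cong (_* n) (expConst-*-2α α 0<α) ⟩
  (1ℚ - 2ℚ * α) * n   ∎
  where
  open ≡-Reasoning
  c : ℚ
  c = expConst α 0<α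

any-tabulate⁻ : ∀ {n} (f : Fin n → Bool) → foldr′ _∨_ false (tabulate f) ≡ true → ∃[ x ] f x ≡ true
any-tabulate⁻ {ℕ.suc n} f any≡true with f zero in f0≡true
... | true  = zero , f0≡true
... | false = let x , fx≡true = any-tabulate⁻ (f ∘ suc) any≡true in suc x , fx≡true

any-tabulate⁺ : ∀ {n} (f : Fin n → Bool) {x} → f x ≡ true → foldr′ _∨_ false (tabulate f) ≡ true
any-tabulate⁺ f {zero}  fx≡true rewrite fx≡true = refl
any-tabulate⁺ f {suc x} fx≡true with f zero
... | true  = refl
... | false = any-tabulate⁺ (f ∘ suc) fx≡true

∧≡true⁻ : ∀ {a b} → a ∧ b ≡ true → a ≡ true × b ≡ true
∧≡true⁻ {true} {true} refl = refl , refl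

∣p∪q∣+∣p∩q∣≡∣p∣+∣q∣ : ∀ {n} (p q : Subset n) → ∣ p ∪ q ∣ ℕ.+ ∣ p ∩ q ∣ ≡ ∣ p ∣ ℕ.+ ∣ q ∣
∣p∪q∣+∣p∩q∣≡∣p∣+∣q∣ []            []            = refl
∣p∪q∣+∣p∩q∣≡∣p∣+∣q∣ (outside ∷ p) (outside ∷ q) = ∣p∪q∣+∣p∩q∣≡∣p∣+∣q∣ p q
∣p∪q∣+∣p∩q∣≡∣p∣+∣q∣ (inside  ∷ p) (outside ∷ q) = cong ℕ.suc (∣p∪q∣+∣p∩q∣≡∣p∣+∣q∣ p q)
∣p∪q∣+∣p∩q∣≡∣p∣+∣q∣ (outside ∷ p) (inside  ∷ q) =
  trans (cong ℕ.suc (∣p∪q∣+∣p∩q∣≡∣p∣+∣q∣ p q)) (sym (ℕ.+-suc ∣ p ∣ ∣ q ∣))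
∣p∪q∣+∣p∩q∣≡∣p∣+∣q∣ (inside  ∷ p) (inside  ∷ q) =
  cong ℕ.suc (trans (ℕ.+-suc ∣ p ∪ q ∣ ∣ p ∩ q ∣)
                    (trans (cong ℕ.suc (∣p∪q∣+∣p∩q∣≡∣p∣+∣q∣ p q)) (sym (ℕ.+-suc ∣ p ∣ ∣ q ∣))))

∣p∪q∣≤∣p∣+∣q∣ : ∀ {n} (p q : Subset n) → ∣ p ∪ q ∣ ℕ.≤ ∣ p ∣ ℕ.+ ∣ q ∣
∣p∪q∣≤∣p∣+∣q∣ p q = subst (∣ p ∪ q ∣ ℕ.≤_) (∣p∪q∣+∣p∩q∣≡∣p∣+∣q∣ p q) (ℕ.m≤m+n ∣ p ∪ q ∣ ∣ p ∩ q ∣)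

q⊆∁p⇒∣p∪q∣≡∣p∣+∣q∣ : ∀ {n} (p q : Subset n) → q ⊆ ∁ p → ∣ p ∪ q ∣ ≡ ∣ p ∣ ℕ.+ ∣ q ∣
q⊆∁p⇒∣p∪q∣≡∣p∣+∣q∣ {n} p q q⊆∁p = begin
  ∣ p ∪ q ∣                    ≡⟨ ℕ.+-identityʳ ∣ p ∪ q ∣ ⟨
  ∣ p ∪ q ∣ ℕ.+ 0              ≡⟨ cong (∣ p ∪ q ∣ ℕ.+_) (∣⊥∣≡0 n) ⟨
  ∣ p ∪ q ∣ ℕ.+ ∣ ⊥ {n} ∣      ≡⟨ cong (λ r → ∣ p ∪ q ∣ ℕ.+ ∣ r ∣) p∩q≡⊥ ⟨
  ∣ p ∪ q ∣ ℕ.+ ∣ p ∩ q ∣      ≡⟨ ∣p∪q∣+∣p∩q∣≡∣p∣+∣q∣ p q ⟩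
  ∣ p ∣ ℕ.+ ∣ q ∣              ∎
  where
  open ≡-Reasoning
  p∩q≡⊥ : p ∩ q ≡ ⊥
  p∩q≡⊥ = Empty-unique λ (x , x∈p∩q) → let x∈p , x∈q = x∈p∩q⁻ p q x∈p∩q in x∈∁p⇒x∉p (q⊆∁p x∈q) x∈p

∣∁p∣+∣p∣≡n : ∀ {n} (p : Subset n) → ∣ ∁ p ∣ ℕ.+ ∣ p ∣ ≡ n
∣∁p∣+∣p∣≡n p = trans (cong (ℕ._+ ∣ p ∣) (∣∁p∣≡n∸∣p∣ p)) (ℕ.m∸n+n≡m (∣p∣≤n p))

q⊆∁p⇒∣p∣<∣p∪q∣ : ∀ {n} (p q : Subset n) → q ⊆ ∁ p → 0 ℕ.< ∣ q ∣ → ∣ p ∣ ℕ.< ∣ p ∪ q ∣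
q⊆∁p⇒∣p∣<∣p∪q∣ p q q⊆∁p 0<∣q∣ =
  subst (∣ p ∣ ℕ.<_) (sym (q⊆∁p⇒∣p∪q∣≡∣p∣+∣q∣ p q q⊆∁p)) (ℕ.m<m+n ∣ p ∣ 0<∣q∣)

p⊆q⇒∁q⊆∁p : ∀ {n} {p q : Subset n} → p ⊆ q → ∁ q ⊆ ∁ p
p⊆q⇒∁q⊆∁p p⊆q x∈∁q = x∉p⇒x∈∁p (x∈∁p⇒x∉p x∈∁q ∘ p⊆q)

∣_∣ℚ : ∀ {n} → Subset n → ℚ
∣ p ∣ℚ = ℕ→ℚ ∣ p ∣

p⊆q∪r⇒∣p∣ℚ≤∣q∣ℚ+∣r∣ℚ : ∀ {n} {p : Subset n} q r → p ⊆ q ∪ r → ∣ p ∣ℚ ≤ ∣ q ∣ℚ + ∣ r ∣ℚ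
p⊆q∪r⇒∣p∣ℚ≤∣q∣ℚ+∣r∣ℚ q r p⊆q∪r = subst (_ ≤_) (ℕ→ℚ-+ ∣ q ∣ ∣ r ∣)
  (ℕ→ℚ-mono-≤ (ℕ.≤-trans (p⊆q⇒∣p∣≤∣q∣ p⊆q∪r) (∣p∪q∣≤∣p∣+∣q∣ q r)))

∣∁p∣ℚ+∣p∣ℚ≡n : ∀ {n} (p : Subset n) → ∣ ∁ p ∣ℚ + ∣ p ∣ℚ ≡ ℕ→ℚ n
∣∁p∣ℚ+∣p∣ℚ≡n p = trans (sym (ℕ→ℚ-+ ∣ ∁ p ∣ ∣ p ∣)) (cong ℕ→ℚ (∣∁p∣+∣p∣≡n p))

module _ {N : ℕ} (i : Side) (G : BipGraph N) where

  ∈-nbhd⁻ : ∀ W U {y} → y ∈ nbhd i G W U → y ∈ W × ∃[ x ] x ∈ U × adjFrom i G x y ≡ true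
  ∈-nbhd⁻ W U {y} y∈nbhd =
    let y∈W , adjacent = ∧≡true⁻ (trans (sym (lookup∘tabulate _ y)) ([]=⇒lookup y∈nbhd))
        x , x∈U∧xy = any-tabulate⁻ _ adjacent
        x∈U , xy = ∧≡true⁻ x∈U∧xy
    in lookup⇒[]= y W y∈W , x , lookup⇒[]= x U x∈U , xy

  ∈-nbhd⁺ : ∀ {W U x y} → y ∈ W → x ∈ U → adjFrom i G x y ≡ true → y ∈ nbhd i G W U
  ∈-nbhd⁺ {W} {U} {x} {y} y∈W x∈U xy = lookup⇒[]= y (nbhd i G W U) (trans (lookup∘tabulate _ y)
    (cong₂ _∧_ ([]=⇒lookup y∈W) (any-tabulate⁺ _ {x} (cong₂ _∧_ ([]=⇒lookup x∈U) xy))))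

  nbhd-∪ : ∀ W X U → nbhd i G W (X ∪ U) ⊆ nbhd i G W X ∪ nbhd i G W U
  nbhd-∪ W X U y∈nbhd with ∈-nbhd⁻ W (X ∪ U) y∈nbhd
  ... | y∈W , x , x∈X∪U , xy with x∈p∪q⁻ X U x∈X∪U
  ...   | inj₁ x∈X = x∈p∪q⁺ (inj₁ (∈-nbhd⁺ y∈W x∈X xy))
  ...   | inj₂ x∈U = x∈p∪q⁺ (inj₂ (∈-nbhd⁺ y∈W x∈U xy))

  nbhd-monoˡ : ∀ {W W′} U → W ⊆ W′ → nbhd i G W U ⊆ nbhd i G W′ U
  nbhd-monoˡ {W} U W⊆W′ y∈nbhd =
    let y∈W , x , x∈U , xy = ∈-nbhd⁻ W U y∈nbhd in ∈-nbhd⁺ (W⊆W′ y∈W) x∈U xy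

  nbhd-⊥ : ∀ W → nbhd i G W ⊥ ⊆ ⊥
  nbhd-⊥ W y∈nbhd = let _ , _ , x∈⊥ , _ = ∈-nbhd⁻ W ⊥ y∈nbhd in ⊥-elim (∉⊥ x∈⊥)

  nbhd-⊤⊆nbhd-∁∪ : ∀ U T → nbhd i G ⊤ U ⊆ nbhd i G (∁ T) U ∪ T
  nbhd-⊤⊆nbhd-∁∪ U T {y} y∈nbhd with y ∈? T
  ... | yes y∈T = x∈p∪q⁺ (inj₂ y∈T)
  ... | no  y∉T =
    let _ , x , x∈U , xy = ∈-nbhd⁻ ⊤ U y∈nbhd in x∈p∪q⁺ (inj₁ (∈-nbhd⁺ (x∉p⇒x∈∁p y∉T) x∈U xy))

module _ {a ℓ₁ ℓ₂} {A : Set a} {Valid : Pred A ℓ₁} {Stable : Pred A ℓ₂} (μ : A → ℕ) (bound : ℕ)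
         (μ≤bound : ∀ {x} → Valid x → μ x ℕ.≤ bound)
         (stable-or-grow : ∀ {x} → Valid x → Stable x ⊎ ∃[ y ] Valid y × μ x ℕ.< μ y) where

  reach-stable : ∀ {x} → Valid x → ∃[ y ] Valid y × Stable y
  reach-stable {x} valid = go valid (<-wellFounded (bound ℕ.∸ μ x))
    where
    go : ∀ {x} → Valid x → Acc ℕ._<_ (bound ℕ.∸ μ x) → ∃[ y ] Valid y × Stable y
    go {x} valid (acc rec) with stable-or-grow valid
    ... | inj₁ stable                 = x , valid , stable
    ... | inj₂ (y , valid′ , μx<μy) = go valid′ (rec (ℕ.∸-monoʳ-< μx<μy (μ≤bound valid′)))

module Greedy (α : ℚ) (0<α : 0ℚ < α) {N : ℕ} (G : BipGraph N) (joined : Joined α G) where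

  n a c : ℚ
  n = ℕ→ℚ N
  a = α * n
  c = expConst α 0<α

  ∣∁nbhd∣<a : ∀ i U → a ≤ ∣ U ∣ℚ → ∣ ∁ (nbhd i G ⊤ U) ∣ℚ < a
  ∣∁nbhd∣<a side0 U a≤∣U∣ = ≰⇒> λ a≤∣B∣ →
    let _ , _ , x∈U , y∈B , xy = joined U _ a≤∣U∣ a≤∣B∣ in x∈∁p⇒x∉p y∈B (∈-nbhd⁺ side0 G ∈⊤ x∈U xy)
  ∣∁nbhd∣<a side1 U a≤∣U∣ = ≰⇒> λ a≤∣B∣ →
    let _ , _ , x∈B , y∈U , xy = joined _ U a≤∣B∣ a≤∣U∣ in x∈∁p⇒x∉p x∈B (∈-nbhd⁺ side1 G ∈⊤ y∈U xy)

  large-sets-expand : ∀ i U T → a ≤ ∣ U ∣ℚ → ∣ T ∣ℚ ≤ a → (1ℚ - 2ℚ * α) * n < ∣ nbhd i G (∁ T) U ∣ℚ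
  large-sets-expand i U T a≤∣U∣ ∣T∣≤a =
    subst (_< x) (sym ([1-2α]n≡n-[αn+αn] α n)) (p<q+r⇒p-r<q n<x+[a+a])
    where
    open ≤-Reasoning
    M : Subset N
    M = nbhd i G ⊤ U
    x : ℚ
    x = ∣ nbhd i G (∁ T) U ∣ℚ
    n<x+[a+a] : n < x + (a + a)
    n<x+[a+a] = begin-strict
      n                     ≡⟨ ∣∁p∣ℚ+∣p∣ℚ≡n M ⟨
      ∣ ∁ M ∣ℚ + ∣ M ∣ℚ      ≤⟨ +-monoʳ-≤ ∣ ∁ M ∣ℚ (p⊆q∪r⇒∣p∣ℚ≤∣q∣ℚ+∣r∣ℚ _ T (nbhd-⊤⊆nbhd-∁∪ i G U T)) ⟩
      ∣ ∁ M ∣ℚ + (x + ∣ T ∣ℚ) <⟨ +-mono-<-≤ (∣∁nbhd∣<a i U a≤∣U∣) (+-monoʳ-≤ x ∣T∣≤a) ⟩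
      a + (x + a)           ≡⟨ solve 2 (λ a x → a :+ (x :+ a) := x :+ (a :+ a)) refl a x ⟩
      x + (a + a)           ∎

  record Sparse (i : Side) (X Y : Subset N) : Set where
    constructor sparse
    field
      bounded        : ∣ X ∣ℚ ≤ a
      few-neighbours : ∣ nbhd i G (∁ Y) X ∣ℚ ≤ c * ∣ X ∣ℚ

  record NonExpanding (i : Side) (X Y U : Subset N) : Set where
    constructor nonExpanding
    field
      disjoint  : U ⊆ ∁ X
      nonempty  : 0ℚ < ∣ U ∣ℚ
      sparseSet : Sparse i U Y

  nonExpanding? : ∀ i X Y U → Dec (NonExpanding i X Y U)
  nonExpanding? i X Y U = map′ fromConditions toConditions
    (U ⊆? ∁ X ×-dec 0ℚ <? ∣ U ∣ℚ ×-dec ∣ U ∣ℚ ≤? a ×-dec ∣ nbhd i G (∁ Y) U ∣ℚ ≤? c * ∣ U ∣ℚ)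
    where
    Conditions : Set
    Conditions = U ⊆ ∁ X × 0ℚ < ∣ U ∣ℚ × ∣ U ∣ℚ ≤ a × ∣ nbhd i G (∁ Y) U ∣ℚ ≤ c * ∣ U ∣ℚ
    fromConditions : Conditions → NonExpanding i X Y U
    fromConditions (U⊆∁X , 0<∣U∣ , ∣U∣≤a , ∣ΓU∣≤c∣U∣) = nonExpanding U⊆∁X 0<∣U∣ (sparse ∣U∣≤a ∣ΓU∣≤c∣U∣)
    toConditions : NonExpanding i X Y U → Conditions
    toConditions (nonExpanding U⊆∁X 0<∣U∣ (sparse ∣U∣≤a ∣ΓU∣≤c∣U∣)) = U⊆∁X , 0<∣U∣ , ∣U∣≤a , ∣ΓU∣≤c∣U∣

  sparse-⊥ : ∀ i Y → Sparse i ⊥ Y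
  sparse-⊥ i Y = sparse (≤-trans (≤-reflexive ∣⊥∣ℚ≡0) 0≤a) (begin
    ∣ nbhd i G (∁ Y) ⊥ ∣ℚ ≤⟨ ℕ→ℚ-mono-≤ (p⊆q⇒∣p∣≤∣q∣ (nbhd-⊥ i G (∁ Y))) ⟩
    ∣ ⊥ {N} ∣ℚ            ≡⟨ ∣⊥∣ℚ≡0 ⟩
    0ℚ                    ≡⟨ *-zeroʳ c ⟨
    c * 0ℚ                ≡⟨ cong (c *_) ∣⊥∣ℚ≡0 ⟨
    c * ∣ ⊥ {N} ∣ℚ        ∎)
    where
    open ≤-Reasoning
    ∣⊥∣ℚ≡0 : ∣ ⊥ {N} ∣ℚ ≡ 0ℚ
    ∣⊥∣ℚ≡0 = cong ℕ→ℚ (∣⊥∣≡0 N)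
    0≤a : 0ℚ ≤ a
    0≤a = subst (_≤ a) (*-zeroˡ n) (*-monoʳ-≤-nonNeg n {{nonNegative (ℕ→ℚ-nonNeg N)}} (<⇒≤ 0<α))

  sparse-monoʳ : ∀ {i X Y Y′} → Y ⊆ Y′ → Sparse i X Y → Sparse i X Y′
  sparse-monoʳ {i} {X} Y⊆Y′ (sparse ∣X∣≤a ∣ΓX∣≤c∣X∣) =
    sparse ∣X∣≤a (≤-trans (ℕ→ℚ-mono-≤ (p⊆q⇒∣p∣≤∣q∣ (nbhd-monoˡ i G X (p⊆q⇒∁q⊆∁p Y⊆Y′)))) ∣ΓX∣≤c∣X∣)

  -- c ≥ 0 is not assumed (α may exceed 1/2); a non-expanding set witnesses it.
  sparse-∪ : ∀ {i X Y U} → Sparse i X Y → ∣ Y ∣ℚ ≤ a → NonExpanding i X Y U → Sparse i (X ∪ U) Y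
  sparse-∪ {i} {X} {Y} {U} (sparse ∣X∣≤a ∣ΓX∣≤c∣X∣) ∣Y∣≤a
           (nonExpanding U⊆∁X 0<∣U∣ (sparse ∣U∣≤a ∣ΓU∣≤c∣U∣)) =
    sparse (≮⇒≥ too-large) (≤-trans ∣Γ[X∪U]∣≤c[∣X∣+∣U∣] (≤-reflexive (cong (c *_) (sym ∣X∪U∣≡∣X∣+∣U∣))))
    where
    Γ : Subset N → Subset N
    Γ = nbhd i G (∁ Y)
    0≤c : 0ℚ ≤ c
    0≤c = *-cancelʳ-≤-pos ∣ U ∣ℚ {{positive 0<∣U∣}}
            (subst (_≤ c * ∣ U ∣ℚ) (sym (*-zeroˡ ∣ U ∣ℚ)) (≤-trans (ℕ→ℚ-nonNeg ∣ Γ U ∣) ∣ΓU∣≤c∣U∣))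
    ∣Γ[X∪U]∣≤c[∣X∣+∣U∣] : ∣ Γ (X ∪ U) ∣ℚ ≤ c * (∣ X ∣ℚ + ∣ U ∣ℚ)
    ∣Γ[X∪U]∣≤c[∣X∣+∣U∣] = begin
      ∣ Γ (X ∪ U) ∣ℚ          ≤⟨ p⊆q∪r⇒∣p∣ℚ≤∣q∣ℚ+∣r∣ℚ (Γ X) (Γ U) (nbhd-∪ i G (∁ Y) X U) ⟩
      ∣ Γ X ∣ℚ + ∣ Γ U ∣ℚ     ≤⟨ +-mono-≤ ∣ΓX∣≤c∣X∣ ∣ΓU∣≤c∣U∣ ⟩
      c * ∣ X ∣ℚ + c * ∣ U ∣ℚ ≡⟨ *-distribˡ-+ c ∣ X ∣ℚ ∣ U ∣ℚ ⟨
      c * (∣ X ∣ℚ + ∣ U ∣ℚ)   ∎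
      where open ≤-Reasoning
    ∣X∪U∣≡∣X∣+∣U∣ : ∣ X ∪ U ∣ℚ ≡ ∣ X ∣ℚ + ∣ U ∣ℚ
    ∣X∪U∣≡∣X∣+∣U∣ = trans (cong ℕ→ℚ (q⊆∁p⇒∣p∪q∣≡∣p∣+∣q∣ X U U⊆∁X)) (ℕ→ℚ-+ ∣ X ∣ ∣ U ∣)
    too-large : ¬ a < ∣ X ∪ U ∣ℚ
    too-large a<∣X∪U∣ = <-irrefl refl (begin-strict
      (1ℚ - 2ℚ * α) * n     <⟨ large-sets-expand i (X ∪ U) Y (<⇒≤ a<∣X∪U∣) ∣Y∣≤a ⟩
      ∣ Γ (X ∪ U) ∣ℚ        ≤⟨ ∣Γ[X∪U]∣≤c[∣X∣+∣U∣] ⟩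
      c * (∣ X ∣ℚ + ∣ U ∣ℚ) ≤⟨ *-monoˡ-≤-nonNeg c {{nonNegative 0≤c}} (+-mono-≤ ∣X∣≤a ∣U∣≤a) ⟩
      c * (a + a)           ≡⟨ expConst-*-[αn+αn] α 0<α n ⟩
      (1ℚ - 2ℚ * α) * n     ∎)
      where open ≤-Reasoning

  -- S i is the part of V_i deleted so far; the subgraph kept is spanned by ∁ (S side0) and ∁ (S side1).
  Removed : Set
  Removed = Side → Subset N

  Admissible : Removed → Set
  Admissible S = ∀ i → Sparse i (S i) (S (other i))

  Stable : Removed → Set
  Stable S = ∀ i U → ¬ NonExpanding i (S i) (S (other i)) U

  extend : Side → Subset N → Removed → Removed
  extend side0 U S side0 = S side0 ∪ U
  extend side0 U S side1 = S side1
  extend side1 U S side0 = S side0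
  extend side1 U S side1 = S side1 ∪ U

  admissible-extend : ∀ {S} i {U} → Admissible S → NonExpanding i (S i) (S (other i)) U →
                      Admissible (extend i U S)
  admissible-extend side0 adm ne side0 = sparse-∪ (adm side0) (Sparse.bounded (adm side1)) ne
  admissible-extend side0 adm ne side1 = sparse-monoʳ (p⊆p∪q _) (adm side1)
  admissible-extend side1 adm ne side0 = sparse-monoʳ (p⊆p∪q _) (adm side0)
  admissible-extend side1 adm ne side1 = sparse-∪ (adm side1) (Sparse.bounded (adm side0)) ne

  size : Removed → ℕ
  size S = ∣ S side0 ∣ ℕ.+ ∣ S side1 ∣

  size-extend : ∀ {S} i {U} → NonExpanding i (S i) (S (other i)) U → size S ℕ.< size (extend i U S)
  size-extend {S} side0 {U} (nonExpanding U⊆∁S 0<∣U∣ _) =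
    ℕ.+-monoˡ-< ∣ S side1 ∣ (q⊆∁p⇒∣p∣<∣p∪q∣ (S side0) U U⊆∁S (ℕ→ℚ-cancel-< 0<∣U∣))
  size-extend {S} side1 {U} (nonExpanding U⊆∁S 0<∣U∣ _) =
    ℕ.+-monoʳ-< ∣ S side0 ∣ (q⊆∁p⇒∣p∣<∣p∪q∣ (S side1) U U⊆∁S (ℕ→ℚ-cancel-< 0<∣U∣))

  size≤2N : ∀ S → size S ℕ.≤ N ℕ.+ N
  size≤2N S = ℕ.+-mono-≤ (∣p∣≤n (S side0)) (∣p∣≤n (S side1))

  stable-or-extend : ∀ {S} → Admissible S → Stable S ⊎ ∃[ S′ ] Admissible S′ × size S ℕ.< size S′
  stable-or-extend {S} adm =
    decide (anySubset? (nonExpanding? side0 (S side0) (S side1)))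
           (anySubset? (nonExpanding? side1 (S side1) (S side0)))
    where
    extension : ∀ i → ∃ (NonExpanding i (S i) (S (other i))) → ∃[ S′ ] Admissible S′ × size S ℕ.< size S′
    extension i (U , ne) = extend i U S , admissible-extend {S} i adm ne , size-extend {S} i ne
    decide : Dec (∃ (NonExpanding side0 (S side0) (S side1))) →
             Dec (∃ (NonExpanding side1 (S side1) (S side0))) →
             Stable S ⊎ ∃[ S′ ] Admissible S′ × size S ℕ.< size S′
    decide (yes ne₀) _         = inj₂ (extension side0 ne₀)
    decide (no _)    (yes ne₁) = inj₂ (extension side1 ne₁)
    decide (no ¬ne₀) (no ¬ne₁) = inj₁ λ { side0 U ne → ¬ne₀ (U , ne) ; side1 U ne → ¬ne₁ (U , ne) }

  admissible-stable : ∃[ S ] Admissible S × Stable S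
  admissible-stable =
    reach-stable size (N ℕ.+ N) (λ {S} _ → size≤2N S) stable-or-extend {λ _ → ⊥} (λ i → sparse-⊥ i ⊥)

  remaining-large : ∀ {S} → Admissible S → ∀ i → (1ℚ - α) * n ≤ ∣ ∁ (S i) ∣ℚ
  remaining-large {S} adm i = subst (_≤ ∣ ∁ (S i) ∣ℚ) (sym ([1-α]n≡n-αn α n)) (p≤q+r⇒p-r≤q (begin
    n                           ≡⟨ ∣∁p∣ℚ+∣p∣ℚ≡n (S i) ⟨
    ∣ ∁ (S i) ∣ℚ + ∣ S i ∣ℚ     ≤⟨ +-monoʳ-≤ ∣ ∁ (S i) ∣ℚ (Sparse.bounded (adm i)) ⟩
    ∣ ∁ (S i) ∣ℚ + a            ∎))
    where open ≤-Reasoning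

  small-sets-expand : ∀ {S} → Stable S → ∀ i U → U ⊆ ∁ (S i) → 0ℚ < ∣ U ∣ℚ → ∣ U ∣ℚ ≤ a →
                      c * ∣ U ∣ℚ < ∣ nbhd i G (∁ (S (other i))) U ∣ℚ
  small-sets-expand stable i U U⊆∁S 0<∣U∣ ∣U∣≤a =
    ≰⇒> λ ∣ΓU∣≤c∣U∣ → stable i U (nonExpanding U⊆∁S 0<∣U∣ (sparse ∣U∣≤a ∣ΓU∣≤c∣U∣))

lemma3p2 : (α : ℚ) (0<α : 0ℚ < α) → α < 1ℚ →
    (N : ℕ) (G : BipGraph N) → Joined α G →
    ∃₂ λ (V₀' V₁' : Subset N) →
      ((1ℚ - α) * ℕ→ℚ N ≤ ℕ→ℚ ∣ V₀' ∣ × (1ℚ - α) * ℕ→ℚ N ≤ ℕ→ℚ ∣ V₁' ∣)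
      × ((i : Side) (U : Subset N) → U ⊆ part i V₀' V₁' →
          0ℚ < ℕ→ℚ ∣ U ∣ → ℕ→ℚ ∣ U ∣ ≤ α * ℕ→ℚ N →
          expConst α 0<α * ℕ→ℚ ∣ U ∣ < ℕ→ℚ ∣ nbhd i G (part (other i) V₀' V₁') U ∣)
      × ((i : Side) (U : Subset N) → U ⊆ part i V₀' V₁' →
          α * ℕ→ℚ N < ℕ→ℚ ∣ U ∣ →
          (1ℚ - 2ℚ * α) * ℕ→ℚ N < ℕ→ℚ ∣ nbhd i G (part (other i) V₀' V₁') U ∣)
lemma3p2 α 0<α _ N G joined =
  let S , adm , stable = admissible-stable in
  ∁ (S side0) , ∁ (S side1)
  , (remaining-large adm side0 , remaining-large adm side1)
  , (λ { side0 → small-sets-expand stable side0 ; side1 → small-sets-expand stable side1 })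
  , λ { side0 U _ a<∣U∣ → large-sets-expand side0 U (S side1) (<⇒≤ a<∣U∣) (Sparse.bounded (adm side1))
      ; side1 U _ a<∣U∣ → large-sets-expand side1 U (S side0) (<⇒≤ a<∣U∣) (Sparse.bounded (adm side0)) }
  where open Greedy α 0<α G joined
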